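{- Let $M$ be an indecomposable matching on $[2n]$ and let $e$ be any edge of $M$. Then there is a sequence of edges $p_1=e,p_2,\dots,p_m$ of $M$ that is a proper right-reaching pin sequence, i.e.: for each $2\le i\le m$, $p_i$ has exactly one endpoint in the shadow of $\{p_1,\dots,p_{i-1}\}$; for each $3\le i\le m$, $p_i$ does not have exactly one endpoint in the shadow of $\{p_1,\dots,p_{i-2}\}$; and $p_m$ is incident with the vertex $2n$.
   Context: A matching is a graph on the vertex set $[2n]=\{1,\dots,2n\}$ in which every vertex is incident to exactly one edge. An interval of a matching is a contiguous segment $[i,j]$ of vertices such that no vertex of $[i,j]$ is adjacent to a vertex outside $[i,j]$; the empty set and $[2n]$ are the trivial intervals, and the matching is indecomposable if it has no other intervals. The shadow of a set of edges is the smallest contiguous segment of vertices containing all their endpoints. -}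

module Defs where

open import Data.Nat using (ℕ; suc; _*_; _≤_; _<_)
open import Data.Product using (Σ; _×_; ∃; ∃-syntax)
open import Data.Sum using (_⊎_)
open import Relation.Nullary using (¬_)
open import Relation.Binary.PropositionalEquality using (_≡_; _≢_)

InRange : ℕ → ℕ → Set
InRange n v = 1 ≤ v × v ≤ 2 * n

-- A matching on [2n], given by its "mate" function: every vertex v of [2n]
-- is joined to exactly one vertex mate v ≠ v of [2n], and mate is an involution
-- on [2n].  (Values of mate outside [2n] are irrelevant.)
record Matching (n : ℕ) : Set where
  field
    mate      : ℕ → ℕ
    mate-rng  : ∀ v → InRange n v → InRange n (mate v)
    mate-irr  : ∀ v → InRange n v → mate v ≢ v
    mate-inv  : ∀ v → InRange n v → mate (mate v) ≡ v
open Matching public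

IsInterval : ∀ {n} → Matching n → ℕ → ℕ → Set
IsInterval {n} M i j =
  1 ≤ i × i ≤ j × j ≤ 2 * n ×
  (∀ v → i ≤ v → v ≤ j → i ≤ mate M v × mate M v ≤ j)

-- Indecomposable: the only nonempty interval is [1,2n]
-- (the empty set is the other trivial interval).
Indecomposable : ∀ {n} → Matching n → Set
Indecomposable {n} M = ∀ i j → IsInterval M i j → i ≡ 1 × j ≡ 2 * n

-- An edge is represented by one of its endpoints v (the edge {v, mate v}).
IsEndpoint : ∀ {n} → Matching n → ℕ → ℕ → Set
IsEndpoint M v a = a ≡ v ⊎ a ≡ mate M v

InShadow : ∀ {n} → Matching n → (ℕ → ℕ) → ℕ → ℕ → Set
InShadow M p k x =
  ∃[ j₁ ] ∃[ j₂ ] ∃[ a ] ∃[ b ]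
    (1 ≤ j₁ × j₁ ≤ k × 1 ≤ j₂ × j₂ ≤ k ×
     IsEndpoint M (p j₁) a × IsEndpoint M (p j₂) b × a ≤ x × x ≤ b)

ExactlyOneIn : ∀ {n} → Matching n → (ℕ → ℕ) → ℕ → ℕ → Set
ExactlyOneIn M p k v =
  (InShadow M p k v × ¬ InShadow M p k (mate M v)) ⊎
  (¬ InShadow M p k v × InShadow M p k (mate M v))

ProperRightReachingPinSeq : ∀ {n} → Matching n → ℕ → (ℕ → ℕ) → ℕ → Set
ProperRightReachingPinSeq {n} M e p m =
  1 ≤ m ×
  p 1 ≡ e ×
  (∀ i → 1 ≤ i → i ≤ m → InRange n (p i)) ×
  (∀ i → 2 ≤ i → i ≤ m → ExactlyOneIn M p (i Data.Nat.∸ 1) (p i)) ×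
  (∀ i → 3 ≤ i → i ≤ m → ¬ ExactlyOneIn M p (i Data.Nat.∸ 2) (p i)) ×
  IsEndpoint M (p m) (2 * n)

module Submission where

-- Pins only interact with the shadow of the earlier pins, which is a segment
-- [l, r] of vertices.  Call a segment k-reachable ('Reach') if at most k
-- further pins, each separating the current shadow (one endpoint inside, one
-- outside), make it reach the vertex 2n.  The proof has three parts.
--   * Existence: in an indecomposable matching every segment other than
--     [1, 2n] has a vertex whose mate lies outside it; pinning that edge
--     strictly grows the segment, so every segment is reachable.
--   * Union lemma: if the hull of two overlapping segments is k-reachable,
--     then so is one of the two segments.  Consequently ('no-shortcut'), when
--     S is not (k+1)-reachable and S ∪ v is k-reachable, any pin w that makes
--     S ∪ v ∪ w (k-1)-reachable cannot separate S: otherwise S itself would be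
--     k-reachable via w or via v.
--   * Greedy construction: start with e at its exact distance to 2n and
--     always add the first pin of a shortest continuation.  The invariant
--     'Greedy' records that the shadow is exactly k pins from 2n; by the
--     union lemma each new pin is proper, and when k runs out the last pin
--     is incident with 2n.

open import Defs
open import Data.Nat using (ℕ; zero; suc; _+_; _*_; _∸_; _≤_; _<_; z≤n; s≤s; _⊓_; _⊔_; _≤?_; _≟_)
open import Data.Nat.Properties
open import Data.Product using (_×_; _,_; proj₁; proj₂; ∃-syntax)
open import Data.Sum using (_⊎_; inj₁; inj₂)
open import Data.Empty using (⊥-elim)
open import Relation.Nullary using (¬_; Dec; yes; no)
open import Relation.Nullary.Decidable using (_×-dec_; _⊎-dec_; ¬?)
open import Relation.Binary.PropositionalEquality
  using (_≡_; refl; sym; trans; cong; cong₂; subst; subst₂; module ≡-Reasoning)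
open import Algebra.Properties.CommutativeSemigroup ⊓-commutativeSemigroup
  using () renaming (xy∙z≈xz∙y to ⊓-swapʳ; interchange to ⊓-interchange)
open import Algebra.Properties.CommutativeSemigroup ⊔-commutativeSemigroup
  using () renaming (xy∙z≈xz∙y to ⊔-swapʳ; interchange to ⊔-interchange)

⊓-≤-either : ∀ {m n x} → m ⊓ n ≤ x → m ≤ x ⊎ n ≤ x
⊓-≤-either {m} {n} h with ⊓-sel m n
... | inj₁ eq = inj₁ (subst (_≤ _) eq h)
... | inj₂ eq = inj₂ (subst (_≤ _) eq h)

≤-⊔-either : ∀ {m n x} → x ≤ m ⊔ n → x ≤ m ⊎ x ≤ n
≤-⊔-either {m} {n} h with ⊔-sel m n
... | inj₁ eq = inj₁ (subst (_ ≤_) eq h)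
... | inj₂ eq = inj₂ (subst (_ ≤_) eq h)

≤-suc-cases : ∀ {j k} → j ≤ suc k → j ≤ k ⊎ j ≡ suc k
≤-suc-cases j≤1+k with m≤n⇒m<n∨m≡n j≤1+k
... | inj₁ (s≤s j≤k) = inj₁ j≤k
... | inj₂ eq        = inj₂ eq

⊓-spread : ∀ x y z → (x ⊓ y) ⊓ z ≡ (x ⊓ y) ⊓ (x ⊓ z)
⊓-spread x y z = begin
  (x ⊓ y) ⊓ z        ≡⟨ ⊓-assoc x y z ⟩
  x ⊓ (y ⊓ z)        ≡⟨ cong (_⊓ (y ⊓ z)) (⊓-idem x) ⟨
  (x ⊓ x) ⊓ (y ⊓ z)  ≡⟨ ⊓-interchange x x y z ⟩
  (x ⊓ y) ⊓ (x ⊓ z)  ∎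
  where open ≡-Reasoning

⊔-spread : ∀ x y z → (x ⊔ y) ⊔ z ≡ (x ⊔ y) ⊔ (x ⊔ z)
⊔-spread x y z = begin
  (x ⊔ y) ⊔ z        ≡⟨ ⊔-assoc x y z ⟩
  x ⊔ (y ⊔ z)        ≡⟨ cong (_⊔ (y ⊔ z)) (⊔-idem x) ⟨
  (x ⊔ x) ⊔ (y ⊔ z)  ≡⟨ ⊔-interchange x x y z ⟩
  (x ⊔ y) ⊔ (x ⊔ z)  ∎
  where open ≡-Reasoning

record Interval : Set where
  constructor [_,_]
  field
    left right : ℕ
open Interval

infix 4 _∈ᵢ_
_∈ᵢ_ : ℕ → Interval → Set
x ∈ᵢ I = left I ≤ x × x ≤ right I

_∈?_ : ∀ x I → Dec (x ∈ᵢ I)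
x ∈? I = (left I ≤? x) ×-dec (x ≤? right I)

infixl 6 _∪_
_∪_ : Interval → Interval → Interval
I ∪ J = [ left I ⊓ left J , right I ⊔ right J ]

∪-assoc : ∀ I J K → I ∪ J ∪ K ≡ I ∪ (J ∪ K)
∪-assoc I J K = cong₂ [_,_] (⊓-assoc (left I) (left J) (left K)) (⊔-assoc (right I) (right J) (right K))

∪-swapʳ : ∀ I J K → I ∪ J ∪ K ≡ I ∪ K ∪ J
∪-swapʳ I J K = cong₂ [_,_] (⊓-swapʳ (left I) (left J) (left K)) (⊔-swapʳ (right I) (right J) (right K))

∪-spread : ∀ I J K → I ∪ J ∪ K ≡ (I ∪ J) ∪ (I ∪ K)
∪-spread I J K = cong₂ [_,_] (⊓-spread (left I) (left J) (left K)) (⊔-spread (right I) (right J) (right K))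

∈-∪ˡ : ∀ {x I J} → x ∈ᵢ I → x ∈ᵢ I ∪ J
∈-∪ˡ {I = I} {J} (l≤x , x≤r) = ≤-trans (m⊓n≤m (left I) (left J)) l≤x , ≤-trans x≤r (m≤m⊔n (right I) (right J))

∈-∪ʳ : ∀ {x I J} → x ∈ᵢ J → x ∈ᵢ I ∪ J
∈-∪ʳ {I = I} {J} (l≤x , x≤r) = ≤-trans (m⊓n≤n (left I) (left J)) l≤x , ≤-trans x≤r (m≤n⊔m (right I) (right J))

Overlapping : Interval → Interval → Set
Overlapping I J = left I ≤ right J × left J ≤ right I

overlap-∪ˡ : ∀ {I J} K → Overlapping I J → Overlapping (I ∪ K) J
overlap-∪ˡ {I} {J} K (lI≤rJ , lJ≤rI) = ≤-trans (m⊓n≤m (left I) (left K)) lI≤rJ , ≤-trans lJ≤rI (m≤m⊔n (right I) (right K))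

overlap-∪ʳ : ∀ {I J} K → Overlapping I J → Overlapping I (J ∪ K)
overlap-∪ʳ {I} {J} K (lI≤rJ , lJ≤rI) = ≤-trans lI≤rJ (m≤m⊔n (right J) (right K)) , ≤-trans (m⊓n≤m (left J) (left K)) lJ≤rI

∪-overlap : ∀ {S} I J → left S ≤ right S → Overlapping (S ∪ I) (S ∪ J)
∪-overlap {S} I J lS≤rS =
  ≤-trans (m⊓n≤m (left S) (left I)) (≤-trans lS≤rS (m≤m⊔n (right S) (right J))) ,
  ≤-trans (m⊓n≤m (left S) (left J)) (≤-trans lS≤rS (m≤m⊔n (right S) (right I)))

∈-∪-split : ∀ {x I J} → Overlapping I J → x ∈ᵢ I ∪ J → x ∈ᵢ I ⊎ x ∈ᵢ J
∈-∪-split {x} {I} {J} (lI≤rJ , lJ≤rI) (l≤x , x≤r) with left I ≤? x | x ≤? right I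
... | yes lI≤x | yes x≤rI = inj₁ (lI≤x , x≤rI)
... | yes _    | no x≰rI with ≤-⊔-either {right I} x≤r
...   | inj₁ x≤rI = ⊥-elim (x≰rI x≤rI)
...   | inj₂ x≤rJ = inj₂ (≤-trans lJ≤rI (<⇒≤ (≰⇒> x≰rI)) , x≤rJ)
∈-∪-split {x} {I} {J} (lI≤rJ , lJ≤rI) (l≤x , x≤r) | no lI≰x | _ with ⊓-≤-either {left I} l≤x
... | inj₁ lI≤x = ⊥-elim (lI≰x lI≤x)
... | inj₂ lJ≤x = inj₂ (lJ≤x , ≤-trans (<⇒≤ (≰⇒> lI≰x)) lI≤rJ)

Agree : (ℕ → ℕ) → (ℕ → ℕ) → ℕ → Set
Agree p q k = ∀ j → j ≤ k → p j ≡ q j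

agree-≤ : ∀ {p q k k′} → k′ ≤ k → Agree p q k → Agree p q k′
agree-≤ k′≤k agree j j≤k′ = agree j (≤-trans j≤k′ k′≤k)

extend : (ℕ → ℕ) → ℕ → ℕ → ℕ → ℕ
extend p i w j with j ≟ suc i
... | yes _ = w
... | no _  = p j

extend-new : ∀ p i w → extend p i w (suc i) ≡ w
extend-new p i w with suc i ≟ suc i
... | yes _  = refl
... | no ≢ = ⊥-elim (≢ refl)

extend-old : ∀ p i w → Agree p (extend p i w) i
extend-old p i w j j≤i with j ≟ suc i
... | yes refl = ⊥-elim (<-irrefl refl (s≤s j≤i))
... | no _     = refl

module Pins {n : ℕ} (M : Matching n) where

  N : ℕ
  N = 2 * n

  inRange? : ∀ w → Dec (InRange n w)
  inRange? w = (1 ≤? w) ×-dec (w ≤? N)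

  span : ℕ → Interval
  span w = [ w ⊓ mate M w , w ⊔ mate M w ]

  span-left : ∀ w → IsEndpoint M w (left (span w))
  span-left w = ⊓-sel w (mate M w)

  span-right : ∀ w → IsEndpoint M w (right (span w))
  span-right w = ⊔-sel w (mate M w)

  endpoint-∈-span : ∀ w {a} → IsEndpoint M w a → a ∈ᵢ span w
  endpoint-∈-span w (inj₁ refl) = m⊓n≤m w (mate M w) , m≤m⊔n w (mate M w)
  endpoint-∈-span w (inj₂ refl) = m⊓n≤n w (mate M w) , m≤n⊔m w (mate M w)

  span-reaches-end : ∀ {w} → InRange n w → N ≤ right (span w) → IsEndpoint M w N
  span-reaches-end {w} w-rng N≤r with ≤-⊔-either {w} N≤r
  ... | inj₁ N≤w = inj₁ (≤-antisym N≤w (proj₂ w-rng))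
  ... | inj₂ N≤m = inj₂ (≤-antisym N≤m (proj₂ (mate-rng M w w-rng)))

  OneEndIn : (ℕ → Set) → ℕ → Set
  OneEndIn P w = (P w × ¬ P (mate M w)) ⊎ (¬ P w × P (mate M w))

  one-end-transfer : ∀ {P Q : ℕ → Set} {w} → (∀ {x} → P x → Q x) → (∀ {x} → Q x → P x) →
    OneEndIn P w → OneEndIn Q w
  one-end-transfer P⇒Q Q⇒P (inj₁ (p , ¬p)) = inj₁ (P⇒Q p , λ q → ¬p (Q⇒P q))
  one-end-transfer P⇒Q Q⇒P (inj₂ (¬p , p)) = inj₂ ((λ q → ¬p (Q⇒P q)) , P⇒Q p)

  Separates : Interval → ℕ → Set
  Separates S = OneEndIn (_∈ᵢ S)

  separates? : ∀ S w → Dec (Separates S w)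
  separates? S w =
    ((w ∈? S) ×-dec ¬? (mate M w ∈? S)) ⊎-dec (¬? (w ∈? S) ×-dec (mate M w ∈? S))

  separates-nonempty : ∀ {S w} → Separates S w → left S ≤ right S
  separates-nonempty (inj₁ ((l≤x , x≤r) , _)) = ≤-trans l≤x x≤r
  separates-nonempty (inj₂ (_ , (l≤x , x≤r))) = ≤-trans l≤x x≤r

  separates-split : ∀ {I J w} → Overlapping I J → Separates (I ∪ J) w → Separates I w ⊎ Separates J w
  separates-split ov (inj₁ (w∈ , m∉)) with ∈-∪-split ov w∈
  ... | inj₁ w∈I = inj₁ (inj₁ (w∈I , λ m∈ → m∉ (∈-∪ˡ m∈)))
  ... | inj₂ w∈J = inj₂ (inj₁ (w∈J , λ m∈ → m∉ (∈-∪ʳ m∈)))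
  separates-split ov (inj₂ (w∉ , m∈)) with ∈-∪-split ov m∈
  ... | inj₁ m∈I = inj₁ (inj₂ ((λ w∈ → w∉ (∈-∪ˡ w∈)) , m∈I))
  ... | inj₂ m∈J = inj₂ (inj₂ ((λ w∈ → w∉ (∈-∪ʳ w∈)) , m∈J))

  data Reach (S : Interval) : ℕ → Set where
    done : ∀ {k} → N ≤ right S → Reach S k
    step : ∀ {k} w → InRange n w → Separates S w → Reach (S ∪ span w) k → Reach S (suc k)

  reach-suc : ∀ {S k} → Reach S k → Reach S (suc k)
  reach-suc (done N≤r)       = done N≤r
  reach-suc (step w r sep R) = step w r sep (reach-suc R)

  reach? : ∀ S k → Dec (Reach S k)
  reach? S k with N ≤? right S
  ... | yes N≤r = yes (done N≤r)
  reach? S zero    | no N≰r = no λ { (done N≤r) → N≰r N≤r }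
  reach? S (suc k) | no N≰r
    with anyUpTo? (λ w → inRange? w ×-dec separates? S w ×-dec reach? (S ∪ span w) k) (suc N)
  ... | yes (w , _ , w-rng , sep , R) = yes (step w w-rng sep R)
  ... | no none = no λ { (done N≤r) → N≰r N≤r
                       ; (step w w-rng sep R) → none (w , s≤s (proj₂ w-rng) , w-rng , sep , R) }

  least-reach : ∀ {S K} → Reach S K → Reach S 0 ⊎ ∃[ k ] (Reach S (suc k) × ¬ Reach S k)
  least-reach {K = zero}  R = inj₁ R
  least-reach {S} {suc K} R with reach? S K
  ... | yes R′ = least-reach R′
  ... | no ¬R′ = inj₂ (K , R , ¬R′)

  -- A pin separating the hull separates one part and is
  -- used there; the other part just follows along in the induction.
  reach-union : ∀ k {I J} → Overlapping I J → Reach (I ∪ J) k → Reach I k ⊎ Reach J k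
  reach-union k ov (done N≤r) with ≤-⊔-either N≤r
  ... | inj₁ N≤rI = inj₁ (done N≤rI)
  ... | inj₂ N≤rJ = inj₂ (done N≤rJ)
  reach-union (suc k) {I} {J} ov (step w w-rng sep R) with separates-split ov sep
  ... | inj₁ sepI
    with reach-union k (overlap-∪ˡ (span w) ov) (subst (λ T → Reach T k) (∪-swapʳ I J (span w)) R)
  ...   | inj₁ RI = inj₁ (step w w-rng sepI RI)
  ...   | inj₂ RJ = inj₂ (reach-suc RJ)
  reach-union (suc k) {I} {J} ov (step w w-rng sep R) | inj₂ sepJ
    with reach-union k (overlap-∪ʳ (span w) ov) (subst (λ T → Reach T k) (∪-assoc I J (span w)) R)
  ...   | inj₁ RI = inj₁ (reach-suc RI)
  ...   | inj₂ RJ = inj₂ (step w w-rng sepJ RJ)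

  -- If S is not (k+1)-reachable and v is a pin for S, then a pin w that
  -- makes S ∪ v ∪ w k-reachable does not separate S: the union lemma applied
  -- to S ∪ v and S ∪ w would otherwise reach S within k + 1 pins.
  no-shortcut : ∀ {S v w k} → InRange n v → Separates S v → InRange n w →
    ¬ Reach S (suc k) → Reach (S ∪ span v ∪ span w) k → ¬ Separates S w
  no-shortcut {S} {v} {w} {k} v-rng sepv w-rng far R sepw
    with reach-union k (∪-overlap (span v) (span w) (separates-nonempty sepv))
                       (subst (λ T → Reach T k) (∪-spread S (span v) (span w)) R)
  ... | inj₁ Rv = far (step v v-rng sepv Rv)
  ... | inj₂ Rw = far (step w w-rng sepw Rw)

  WellFormed : Interval → Set
  WellFormed S = 1 ≤ left S × left S ≤ right S × right S ≤ N

  span-wellformed : ∀ {w} → InRange n w → WellFormed (span w)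
  span-wellformed {w} w-rng = ⊓-glb (proj₁ w-rng) (proj₁ m-rng) ,
                              ≤-trans (m⊓n≤m w _) (m≤m⊔n w _) ,
                              ⊔-lub (proj₂ w-rng) (proj₂ m-rng)
    where m-rng = mate-rng M w w-rng

  wellformed-∪ : ∀ {I J} → WellFormed I → WellFormed J → WellFormed (I ∪ J)
  wellformed-∪ {I} {J} (1≤lI , lI≤rI , rI≤N) (1≤lJ , _ , rJ≤N) =
    ⊓-glb 1≤lI 1≤lJ , ≤-trans (m⊓n≤m _ _) (≤-trans lI≤rI (m≤m⊔n _ _)) , ⊔-lub rI≤N rJ≤N

  -- Indecomposability: a segment of [1, 2n] not reaching 2n is no interval
  -- of M, so some vertex in it has its mate outside.
  escaping-vertex : Indecomposable M → ∀ {S} → WellFormed S → ¬ N ≤ right S →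
    ∃[ w ] (InRange n w × w ∈ᵢ S × ¬ mate M w ∈ᵢ S)
  escaping-vertex ind {S} (1≤l , l≤r , r≤N) N≰r
    with anyUpTo? (λ w → inRange? w ×-dec (w ∈? S) ×-dec ¬? (mate M w ∈? S)) (suc N)
  ... | yes (w , _ , escapes) = w , escapes
  ... | no none = ⊥-elim (N≰r (≤-reflexive (sym (proj₂ (ind (left S) (right S) (1≤l , l≤r , r≤N , closed))))))
    where
    closed : ∀ v → left S ≤ v → v ≤ right S → mate M v ∈ᵢ S
    closed v l≤v v≤r with mate M v ∈? S
    ... | yes m∈S = m∈S
    ... | no m∉S  = ⊥-elim (none (v , s≤s (≤-trans v≤r r≤N) ,
                                  (≤-trans 1≤l l≤v , ≤-trans v≤r r≤N) , (l≤v , v≤r) , m∉S))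

  gap : Interval → ℕ
  gap S = left S + (N ∸ right S)

  escape-shrinks : ∀ {S w} → WellFormed (S ∪ span w) → ¬ mate M w ∈ᵢ S → gap (S ∪ span w) < gap S
  escape-shrinks {S} {w} (_ , _ , r′≤N) m∉S with left S ≤? mate M w
  ... | no l≰m = +-mono-<-≤ (≤-<-trans (≤-trans (m⊓n≤n (left S) _) (m⊓n≤n w (mate M w))) (≰⇒> l≰m))
                            (∸-monoʳ-≤ N (m≤m⊔n (right S) _))
  ... | yes l≤m = +-mono-≤-< (m⊓n≤m (left S) _)
                             (∸-monoʳ-< (<-≤-trans r<m (≤-trans (m≤n⊔m w _) (m≤n⊔m (right S) _))) r′≤N)
    where r<m = ≰⇒> (λ m≤r → m∉S (l≤m , m≤r))

  reachable : Indecomposable M → ∀ f {S} → WellFormed S → gap S < f → ∃[ k ] Reach S k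
  reachable ind zero wf ()
  reachable ind (suc f) {S} wf gap<f with N ≤? right S
  ... | yes N≤r = 0 , done N≤r
  ... | no N≰r with escaping-vertex ind wf N≰r
  ...   | w , w-rng , w∈S , m∉S with reachable ind f wf′ (<-≤-trans (escape-shrinks wf′ m∉S) (≤-pred gap<f))
    where wf′ = wellformed-∪ wf (span-wellformed w-rng)
  ...     | k , R = suc k , step w w-rng (inj₁ (w∈S , m∉S)) R

  shadow : (ℕ → ℕ) → ℕ → Interval
  shadow p zero          = [ 1 , 0 ]
  shadow p (suc zero)    = span (p 1)
  shadow p (suc (suc k)) = shadow p (suc k) ∪ span (p (suc (suc k)))

  shadow-local : ∀ {p q} k → Agree p q k → shadow p k ≡ shadow q k
  shadow-local zero          agree = refl
  shadow-local (suc zero)    agree = cong span (agree 1 ≤-refl)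
  shadow-local (suc (suc k)) agree =
    cong₂ _∪_ (shadow-local (suc k) (agree-≤ (n≤1+n _) agree)) (cong span (agree (suc (suc k)) ≤-refl))

  -- The shadow contains every endpoint of the pins, and its two ends are
  -- themselves endpoints of pins; so it agrees with 'InShadow'.
  endpoint-∈-shadow : ∀ p k {j a} → 1 ≤ j → j ≤ suc k → IsEndpoint M (p j) a → a ∈ᵢ shadow p (suc k)
  endpoint-∈-shadow p zero (s≤s z≤n) (s≤s z≤n) end = endpoint-∈-span (p 1) end
  endpoint-∈-shadow p (suc k) 1≤j j≤k+2 end with ≤-suc-cases j≤k+2
  ... | inj₁ j≤k+1 = ∈-∪ˡ {J = span (p (2 + k))} (endpoint-∈-shadow p k 1≤j j≤k+1 end)
  ... | inj₂ refl  = ∈-∪ʳ {I = shadow p (suc k)} (endpoint-∈-span (p (2 + k)) end)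

  PinEnd : (ℕ → ℕ) → ℕ → ℕ → Set
  PinEnd p k a = ∃[ j ] (1 ≤ j × j ≤ k × IsEndpoint M (p j) a)

  left-is-pin-end : ∀ p k → PinEnd p (suc k) (left (shadow p (suc k)))
  left-is-pin-end p zero = 1 , ≤-refl , ≤-refl , span-left (p 1)
  left-is-pin-end p (suc k) with ⊓-sel (left (shadow p (suc k))) (left (span (p (suc (suc k)))))
  ... | inj₁ eq with left-is-pin-end p k
  ...   | j , 1≤j , j≤k+1 , end = j , 1≤j , m≤n⇒m≤1+n j≤k+1 , subst (IsEndpoint M (p j)) (sym eq) end
  left-is-pin-end p (suc k) | inj₂ eq =
    suc (suc k) , s≤s z≤n , ≤-refl , subst (IsEndpoint M _) (sym eq) (span-left _)

  right-is-pin-end : ∀ p k → PinEnd p (suc k) (right (shadow p (suc k)))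
  right-is-pin-end p zero = 1 , ≤-refl , ≤-refl , span-right (p 1)
  right-is-pin-end p (suc k) with ⊔-sel (right (shadow p (suc k))) (right (span (p (suc (suc k)))))
  ... | inj₁ eq with right-is-pin-end p k
  ...   | j , 1≤j , j≤k+1 , end = j , 1≤j , m≤n⇒m≤1+n j≤k+1 , subst (IsEndpoint M (p j)) (sym eq) end
  right-is-pin-end p (suc k) | inj₂ eq =
    suc (suc k) , s≤s z≤n , ≤-refl , subst (IsEndpoint M _) (sym eq) (span-right _)

  shadow-sound : ∀ p k {x} → InShadow M p (suc k) x → x ∈ᵢ shadow p (suc k)
  shadow-sound p k (j₁ , j₂ , a , b , 1≤j₁ , j₁≤ , 1≤j₂ , j₂≤ , end-a , end-b , a≤x , x≤b) =
    ≤-trans (proj₁ (endpoint-∈-shadow p k 1≤j₁ j₁≤ end-a)) a≤x ,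
    ≤-trans x≤b (proj₂ (endpoint-∈-shadow p k 1≤j₂ j₂≤ end-b))

  shadow-complete : ∀ p k {x} → x ∈ᵢ shadow p (suc k) → InShadow M p (suc k) x
  shadow-complete p k (l≤x , x≤r) with left-is-pin-end p k | right-is-pin-end p k
  ... | j₁ , 1≤j₁ , j₁≤ , end-l | j₂ , 1≤j₂ , j₂≤ , end-r =
    j₁ , j₂ , _ , _ , 1≤j₁ , j₁≤ , 1≤j₂ , j₂≤ , end-l , end-r , l≤x , x≤r

  separates⇒exactly-one : ∀ p k {w} → Separates (shadow p (suc k)) w → ExactlyOneIn M p (suc k) w
  separates⇒exactly-one p k =
    one-end-transfer {P = _∈ᵢ shadow p (suc k)} {Q = InShadow M p (suc k)} (shadow-complete p k) (shadow-sound p k)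

  exactly-one⇒separates : ∀ p k {w} → ExactlyOneIn M p (suc k) w → Separates (shadow p (suc k)) w
  exactly-one⇒separates p k =
    one-end-transfer {P = InShadow M p (suc k)} {Q = _∈ᵢ shadow p (suc k)} (shadow-sound p k) (shadow-complete p k)

  -- Invariant of the greedy construction: p 1, …, p (s + 2) is a proper pin
  -- sequence from e whose shadow is exactly k pins away from 2n: it is
  -- k-reachable while the shadow of p 1, …, p (s + 1) is not.
  record Greedy (e : ℕ) (p : ℕ → ℕ) (s k : ℕ) : Set where
    field
      starts       : p 1 ≡ e
      in-range     : ∀ j → 1 ≤ j → j ≤ suc (suc s) → InRange n (p j)
      pinned       : ∀ j → 1 ≤ j → j ≤ suc s → Separates (shadow p j) (p (suc j))
      proper       : ∀ j → 1 ≤ j → j ≤ s → ¬ Separates (shadow p j) (p (suc (suc j)))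
      reaches      : Reach (shadow p (suc (suc s))) k
      previous-far : ¬ Reach (shadow p (suc s)) k

  greedy-local : ∀ {e p q s k} → Agree p q (suc (suc s)) → Greedy e p s k → Greedy e q s k
  greedy-local {p = p} {q} {s = s} {k} agree g = record
    { starts       = trans (sym (agree 1 (s≤s z≤n))) starts
    ; in-range     = λ j 1≤j j≤ → subst (InRange n) (agree j j≤) (in-range j 1≤j j≤)
    ; pinned       = λ j 1≤j j≤ → subst₂ Separates (same-shadow (m≤n⇒m≤1+n j≤)) (agree (suc j) (s≤s j≤))
                                          (pinned j 1≤j j≤)
    ; proper       = λ j 1≤j j≤ sep → proper j 1≤j j≤
                       (subst₂ Separates (sym (same-shadow (≤-trans j≤ (m≤n+m s 2))))
                                         (sym (agree (suc (suc j)) (s≤s (s≤s j≤)))) sep)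
    ; reaches      = subst (λ S → Reach S k) (same-shadow ≤-refl) reaches
    ; previous-far = λ R → previous-far (subst (λ S → Reach S k) (sym (same-shadow (n≤1+n _))) R)
    }
    where
    open Greedy g
    same-shadow : ∀ {j} → j ≤ suc (suc s) → shadow p j ≡ shadow q j
    same-shadow j≤ = shadow-local _ (agree-≤ j≤ agree)

  greedy-step : ∀ {e q s k} → Greedy e q s (suc k) →
    InRange n (q (3 + s)) → Separates (shadow q (2 + s)) (q (3 + s)) → Reach (shadow q (3 + s)) k →
    Greedy e q (suc s) k
  greedy-step {q = q} {s} {k} g w-rng sep R = record
    { starts       = starts
    ; in-range     = in-range′
    ; pinned       = pinned′
    ; proper       = proper′
    ; reaches      = R
    ; previous-far = λ R′ → previous-far (step (q (2 + s)) v-rng v-pinned R′)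
    }
    where
    open Greedy g
    v-rng = in-range (2 + s) (s≤s z≤n) ≤-refl
    v-pinned = pinned (suc s) (s≤s z≤n) ≤-refl
    in-range′ : ∀ j → 1 ≤ j → j ≤ 3 + s → InRange n (q j)
    in-range′ j 1≤j j≤ with ≤-suc-cases j≤
    ... | inj₁ j≤′ = in-range j 1≤j j≤′
    ... | inj₂ refl = w-rng
    pinned′ : ∀ j → 1 ≤ j → j ≤ 2 + s → Separates (shadow q j) (q (suc j))
    pinned′ j 1≤j j≤ with ≤-suc-cases j≤
    ... | inj₁ j≤′ = pinned j 1≤j j≤′
    ... | inj₂ refl = sep
    proper′ : ∀ j → 1 ≤ j → j ≤ suc s → ¬ Separates (shadow q j) (q (suc (suc j)))
    proper′ j 1≤j j≤ with ≤-suc-cases j≤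
    ... | inj₁ j≤′ = proper j 1≤j j≤′
    ... | inj₂ refl = no-shortcut v-rng v-pinned w-rng previous-far R

  greedy-start : ∀ {e w k} → InRange n e → InRange n w → Separates (span e) w →
    Reach (span e ∪ span w) k → ¬ Reach (span e) k → Greedy e (extend (λ _ → e) 1 w) 0 k
  greedy-start {e} {w} e-rng w-rng sep R far = record
    { starts       = refl
    ; in-range     = in-range
    ; pinned       = pinned
    ; proper       = λ { (suc _) _ () }
    ; reaches      = R
    ; previous-far = far
    }
    where
    in-range : ∀ j → 1 ≤ j → j ≤ 2 → InRange n (extend (λ _ → e) 1 w j)
    in-range 1 _ _ = e-rng
    in-range 2 _ _ = w-rng
    in-range (suc (suc (suc _))) _ (s≤s (s≤s ()))
    pinned : ∀ j → 1 ≤ j → j ≤ 1 → Separates (shadow (extend (λ _ → e) 1 w) j) (extend (λ _ → e) 1 w (suc j))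
    pinned 1 _ _ = sep
    pinned (suc (suc _)) _ (s≤s ())

  -- Once the shadow reaches 2n, the sequence is a proper right-reaching pin
  -- sequence: the last pin is incident with 2n since the previous shadow
  -- does not reach it.
  greedy-finish : ∀ {e p s k} → Greedy e p s k → N ≤ right (shadow p (2 + s)) →
    ProperRightReachingPinSeq M e p (2 + s)
  greedy-finish {p = p} {s} g N≤r = s≤s z≤n , starts , in-range , pins , proper′ , last-at-end
    where
    open Greedy g
    pins : ∀ i → 2 ≤ i → i ≤ 2 + s → ExactlyOneIn M p (i ∸ 1) (p i)
    pins (suc (suc j)) (s≤s (s≤s _)) i≤ = separates⇒exactly-one p j (pinned (suc j) (s≤s z≤n) (≤-pred i≤))
    proper′ : ∀ i → 3 ≤ i → i ≤ 2 + s → ¬ ExactlyOneIn M p (i ∸ 2) (p i)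
    proper′ (suc (suc (suc j))) (s≤s (s≤s (s≤s _))) i≤ one =
      proper (suc j) (s≤s z≤n) (≤-pred (≤-pred i≤)) (exactly-one⇒separates p j one)
    last-at-end : IsEndpoint M (p (2 + s)) N
    last-at-end with ≤-⊔-either {right (shadow p (suc s))} N≤r
    ... | inj₁ N≤r′ = ⊥-elim (previous-far (done N≤r′))
    ... | inj₂ N≤r″ = span-reaches-end (in-range (2 + s) (s≤s z≤n) ≤-refl) N≤r″

  greedy-complete : ∀ k {e p s} → Greedy e p s k → ∃[ q ] ∃[ m ] ProperRightReachingPinSeq M e q m
  greedy-complete k {p = p} {s} g with Greedy.reaches g
  ... | done N≤r = p , 2 + s , greedy-finish g N≤r
  ... | step w w-rng sep R =
    greedy-complete _ (greedy-step (greedy-local (extend-old p (2 + s) w) g)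
                                   (subst (InRange n) (sym new) w-rng)
                                   (subst₂ Separates old-shadow (sym new) sep)
                                   (subst (λ S → Reach S _) (cong₂ _∪_ old-shadow (cong span (sym new))) R))
    where
    new = extend-new p (2 + s) w
    old-shadow = shadow-local (2 + s) (extend-old p (2 + s) w)

  single-pin : ∀ {e} → InRange n e → N ≤ right (span e) → ProperRightReachingPinSeq M e (λ _ → e) 1
  single-pin e-rng N≤r = ≤-refl , refl , (λ _ _ _ → e-rng) ,
    (λ { i (s≤s (s≤s _)) (s≤s ()) }) , (λ { i (s≤s (s≤s (s≤s _))) (s≤s ()) }) ,
    span-reaches-end e-rng N≤r

open Pins

lemma2p2 : (n : ℕ) (M : Matching n) → Indecomposable M →
    (e : ℕ) → InRange n e →
    ∃[ p ] ∃[ m ] ProperRightReachingPinSeq M e p m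
lemma2p2 n M ind e e-rng
  with least-reach M (proj₂ (reachable M ind _ (span-wellformed M e-rng) (n<1+n (gap M (span M e)))))
... | inj₁ (done N≤r)                       = (λ _ → e) , 1 , single-pin M e-rng N≤r
... | inj₂ (k , done N≤r , far)             = ⊥-elim (far (done N≤r))
... | inj₂ (k , step w w-rng sep R , far) = greedy-complete M k (greedy-start M e-rng w-rng sep R far)
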